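{- For every set $\mathfrak{X}$ of triples on some finite set $B$ of size at least one, there exist a gene tree $T=(V,E)$ with leaf set $L$, an event map $t:V\to\{\bullet,\square,\odot\}$ and a map $\sigma:L\to B$ (assigning to every leaf of $T$ the species in $B$ it resides in) such that $\mathfrak{X}=\mathfrak{S}(T,t,\sigma)$.
   Context: A phylogenetic tree $T=(V,E)$ on leaf set $L\subseteq V$ is a rooted tree with directed edges, root of indegree zero, and no vertex with indegree one and outdegree one. $x\preceq_T y$ iff $y$ lies on the path from $x$ to the root; $x\prec_T y$ means $x\preceq_T y$, $x\ne y$. $L(x)=\{y\in L:y\preceq_T x\}$; $\operatorname{lca}_T(A)$ is the $\preceq_T$-minimal common ancestor of $A$. A triple on $B$ is a rooted tree $((a,b),c)$ with three distinct leaves $a,b,c\in B$ and two interior vertices, in which $a,b$ form a cherry. A triple $((x,y),z)$ on three distinct leaves of $T$ is displayed by $T$ iff $\operatorname{lca}_T(x,y)\prec_T\operatorname{lca}_T(x,y,z)$; $\mathfrak{R}(T)$ is the set of such triples, and $\operatorname{lca}_T(r)=\operatorname{lca}_T(x,y,z)$ for a triple $r$ on $\{x,y,z\}$. A gene tree is a phylogenetic tree $T=(V,E)$ with leaf set $L$; $\sigma:L\to B$; the event map $t$ satisfies $t(x)=\odot$ iff $x\in L$ (interior vertices are speciations $\bullet$ or duplications $\square$), and $(T,t,\sigma)$ satisfies condition (C): if $t(z)=\bullet$ and $T',T''$ are subtrees rooted at two distinct children of $z$, then the $\sigma$-images of their leaf sets are disjoint. $\mathfrak{G}(T,t,\sigma)=\{r\in\mathfrak{R}(T):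 t(\operatorname{lca}_T(r))=\bullet$ and the three leaves of $r$ have pairwise distinct $\sigma$-images$\}$, and $\mathfrak{S}(T,t,\sigma)=\{((\sigma(x),\sigma(y)),\sigma(z)) : ((x,y),z)\in\mathfrak{G}(T,t,\sigma)\}$. -}

module Defs where

open import Data.Nat using (ℕ; zero; suc; _≤_)
open import Data.Fin using (Fin)
open import Data.List using (List; []; _∷_; _++_; length)
open import Data.List.Membership.Propositional using (_∈_)
open import Data.Maybe using (Maybe; just; nothing)
open import Data.Product using (Σ; ∃; _×_; _,_)
open import Data.Sum using (_⊎_)
open import Relation.Binary.PropositionalEquality using (_≡_; _≢_)
open import Relation.Nullary using (¬_)
open import Relation.Nullary.Decidable using (does)
open import Data.Nat using (_≟_)
open import Data.Bool using (if_then_else_)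

-- Triples on a finite set B = Fin m.
-- An (ordered) triple (a , b , c) stands for the rooted triple ((a,b),c).

Triple : ℕ → Set
Triple m = Fin m × Fin m × Fin m

ValidTriple : ∀ {m} → Triple m → Set
ValidTriple (a , b , c) = a ≢ b × a ≢ c × b ≢ c

-- ((a,b),c) and ((a',b'),c') are the same rooted tree
-- iff c = c' and {a,b} = {a',b'}
SameTriple : ∀ {A : Set} → A × A × A → A × A × A → Set
SameTriple (a , b , c) (a' , b' , c') =
  c ≡ c' × ((a ≡ a' × b ≡ b') ⊎ (a ≡ b' × b ≡ a'))

_∈T_ : ∀ {m} → Triple m → List (Triple m) → Set
r ∈T X = ∃ λ s → s ∈ X × SameTriple s r

-- Interior vertices carry an event
-- (speciation • or duplication □); leaves (event ⊙) carry their species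
-- σ(x) ∈ B.  Vertices are identified with their positions (paths from
-- the root, a list of child indices).

data Event : Set where
  spec dup : Event

data Tree (B : Set) : Set where
  leaf : B → Tree B
  node : Event → List (Tree B) → Tree B

Pos : Set
Pos = List ℕ

mutual
  at : ∀ {B} → Tree B → Pos → Maybe (Tree B)
  at t [] = just t
  at (leaf _) (_ ∷ _) = nothing
  at (node _ ts) (i ∷ p) = atList ts i p

  atList : ∀ {B} → List (Tree B) → ℕ → Pos → Maybe (Tree B)
  atList [] _ _ = nothing
  atList (t ∷ ts) zero p = at t p
  atList (t ∷ ts) (suc i) p = atList ts i p

LeafOf : ∀ {B} → Tree B → Pos → B → Set
LeafOf T x a = at T x ≡ just (leaf a)

-- phylogenetic tree: every interior vertex has at least one child, and no
-- vertex other than the root has exactly one child (indegree one and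
-- outdegree one is forbidden; the root has indegree zero)
Phylogenetic : ∀ {B} → Tree B → Set
Phylogenetic T = ∀ p e ts → at T p ≡ just (node e ts) →
  1 ≤ length ts × (p ≢ [] → 2 ≤ length ts)

ConditionC : ∀ {B} → Tree B → Set
ConditionC T = ∀ p ts i j q q' a b →
  at T p ≡ just (node spec ts) → i ≢ j →
  LeafOf T (p ++ (i ∷ q)) a → LeafOf T (p ++ (j ∷ q')) b → a ≢ b

-- x ⪯ y (y on the path from x to the root) iff y is a prefix of x;
-- the lca of positions is their longest common prefix
lcp : Pos → Pos → Pos
lcp [] _ = []
lcp (_ ∷ _) [] = []
lcp (i ∷ p) (j ∷ q) = if does (i ≟ j) then i ∷ lcp p q else []

lca₂ : Pos → Pos → Pos
lca₂ = lcp

lca₃ : Pos → Pos → Pos → Pos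
lca₃ x y z = lcp (lcp x y) z

_≺_ : Pos → Pos → Set
x ≺ y = ∃ λ s → s ≢ [] × x ≡ y ++ s

GeneTriple : ∀ {B} → Tree B → Pos → Pos → Pos → B → B → B → Set
GeneTriple T x y z a b c =
  LeafOf T x a × LeafOf T y b × LeafOf T z c ×
  x ≢ y × x ≢ z × y ≢ z ×
  lca₂ x y ≺ lca₃ x y z ×
  (∃ λ ts → at T (lca₃ x y z) ≡ just (node spec ts)) ×
  a ≢ b × a ≢ c × b ≢ c

_∈𝔖_ : ∀ {m} → Triple m → Tree (Fin m) → Set
r ∈𝔖 T = ∃ λ x → ∃ λ y → ∃ λ z → ∃ λ a → ∃ λ b → ∃ λ c →
  GeneTriple T x y z a b c × SameTriple (a , b , c) r

-- Hang one speciation gadget ((a,b),c) for every triple of X below a common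
-- duplication root.  A triple whose lca is the duplication root is not in 𝔖,
-- so every triple of 𝔖 lives inside a single gadget, and the only speciation
-- triple a gadget displays is its own ((a,b),c).  Condition (C) and the
-- phylogenetic conditions hold gadget by gadget.
module Submission where

open import Defs
open import Data.Nat using (ℕ; suc; zero; _≤_; _≟_; s≤s; z≤n)
open import Data.Nat.Properties using (<⇒≤)
open import Data.Fin using (Fin)
open import Data.List using (List; []; _∷_; map; length)
open import Data.List.Properties using (∷-injectiveʳ; ++-conicalʳ)
open import Data.List.Relation.Unary.All using (All; _∷_; universal)
import Data.List.Relation.Unary.All as All
open import Data.List.Relation.Unary.All.Properties using (map⁺)
open import Data.List.Relation.Unary.Any using (here; there)
open import Data.List.Membership.Propositional using (_∈_)
open import Data.List.Membership.Propositional.Properties using (∈-map⁺; ∈-map⁻)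
open import Data.Maybe using (just)
open import Data.Product using (∃; _×_; _,_)
open import Data.Sum using (inj₁; inj₂)
open import Data.Empty using (⊥-elim)
open import Function.Bundles using (_⇔_; mk⇔)
open import Relation.Binary.PropositionalEquality
  using (_≡_; _≢_; refl; sym; trans; cong; subst; subst₂)
open import Relation.Nullary using (¬_; yes; no)
open import Relation.Nullary.Decidable using (dec-true; dec-false)

at-leaf≢node : ∀ {B} {a : B} p {e ts} → at (leaf a) p ≢ just (node e ts)
at-leaf≢node [] ()
at-leaf≢node (_ ∷ _) ()

atList-child : ∀ {B} (ts : List (Tree B)) i {p u} → atList ts i p ≡ just u →
  ∃ λ t → t ∈ ts × (∀ q → atList ts i q ≡ at t q)
atList-child [] _ ()
atList-child (t ∷ ts) zero _ = t , here refl , λ _ → refl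
atList-child (t ∷ ts) (suc i) h with atList-child ts i h
... | t' , t'∈ts , child = t' , there t'∈ts , child

atList-index : ∀ {B} {ts : List (Tree B)} {t} → t ∈ ts →
  ∃ λ i → ∀ q → atList ts i q ≡ at t q
atList-index (here refl) = zero , λ _ → refl
atList-index (there t∈ts) with atList-index t∈ts
... | i , child = suc i , child

Branching : ∀ {B} → Tree B → Set
Branching T = ∀ p {e ts} → at T p ≡ just (node e ts) → 2 ≤ length ts

leaf-branching : ∀ {B} (a : B) → Branching (leaf a)
leaf-branching _ p h = ⊥-elim (at-leaf≢node p h)

node-phylogenetic : ∀ {B} {e} {ts : List (Tree B)} →
  1 ≤ length ts → All Branching ts → Phylogenetic (node e ts)
node-phylogenetic nonempty _ [] _ _ refl = nonempty , λ []≢[] → ⊥-elim ([]≢[] refl)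
node-phylogenetic {ts = ts} _ branching (i ∷ p) _ _ h with atList-child ts i h
... | t , t∈ts , child = <⇒≤ two , λ _ → two
  where two = All.lookup branching t∈ts p (trans (sym (child p)) h)

leaf-conditionC : ∀ {B} (a : B) → ConditionC (leaf a)
leaf-conditionC _ p _ _ _ _ _ _ _ h = ⊥-elim (at-leaf≢node p h)

dup-conditionC : ∀ {B} {ts : List (Tree B)} → All ConditionC ts → ConditionC (node dup ts)
dup-conditionC _ [] _ _ _ _ _ _ _ ()
dup-conditionC {ts = ts} condC (k ∷ p) us i j q q' a b h i≢j la lb
  with atList-child ts k h
... | t , t∈ts , child =
  All.lookup condC t∈ts p us i j q q' a b
    (trans (sym (child p)) h) i≢j (trans (sym (child _)) la) (trans (sym (child _)) lb)

tripleTree : ∀ {m} → Triple m → Tree (Fin m)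
tripleTree (a , b , c) = node spec (node spec (leaf a ∷ leaf b ∷ []) ∷ leaf c ∷ [])

data TripleTreeLeaf {m} (a b c : Fin m) : Pos → Fin m → Set where
  leafᵃ : TripleTreeLeaf a b c (0 ∷ 0 ∷ []) a
  leafᵇ : TripleTreeLeaf a b c (0 ∷ 1 ∷ []) b
  leafᶜ : TripleTreeLeaf a b c (1 ∷ []) c

tripleTree-leaf : ∀ {m} {a b c : Fin m} p {d} →
  LeafOf (tripleTree (a , b , c)) p d → TripleTreeLeaf a b c p d
tripleTree-leaf [] ()
tripleTree-leaf (0 ∷ []) ()
tripleTree-leaf (0 ∷ 0 ∷ []) refl = leafᵃ
tripleTree-leaf (0 ∷ 0 ∷ _ ∷ _) ()
tripleTree-leaf (0 ∷ 1 ∷ []) refl = leafᵇ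
tripleTree-leaf (0 ∷ 1 ∷ _ ∷ _) ()
tripleTree-leaf (0 ∷ suc (suc _) ∷ _) ()
tripleTree-leaf (1 ∷ []) refl = leafᶜ
tripleTree-leaf (1 ∷ _ ∷ _) ()
tripleTree-leaf (suc (suc _) ∷ _) ()

tripleTree-branching : ∀ {m} (s : Triple m) → Branching (tripleTree s)
tripleTree-branching _ [] refl = s≤s (s≤s z≤n)
tripleTree-branching _ (0 ∷ []) refl = s≤s (s≤s z≤n)
tripleTree-branching _ (0 ∷ 0 ∷ w) h = ⊥-elim (at-leaf≢node w h)
tripleTree-branching _ (0 ∷ 1 ∷ w) h = ⊥-elim (at-leaf≢node w h)
tripleTree-branching _ (0 ∷ suc (suc _) ∷ _) ()
tripleTree-branching _ (1 ∷ w) h = ⊥-elim (at-leaf≢node w h)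
tripleTree-branching _ (suc (suc _) ∷ _) ()

tripleTree-conditionC : ∀ {m} {s : Triple m} → ValidTriple s → ConditionC (tripleTree s)
tripleTree-conditionC {s = a , b , c} (a≢b , a≢c , b≢c) [] _ i j q q' _ _ refl i≢j lx ly
  with tripleTree-leaf (i ∷ q) lx | tripleTree-leaf (j ∷ q') ly
... | leafᵃ | leafᶜ = a≢c
... | leafᵇ | leafᶜ = b≢c
... | leafᶜ | leafᵃ = λ c≡a → a≢c (sym c≡a)
... | leafᶜ | leafᵇ = λ c≡b → b≢c (sym c≡b)
... | leafᵃ | leafᵃ = ⊥-elim (i≢j refl)
... | leafᵃ | leafᵇ = ⊥-elim (i≢j refl)
... | leafᵇ | leafᵃ = ⊥-elim (i≢j refl)
... | leafᵇ | leafᵇ = ⊥-elim (i≢j refl)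
... | leafᶜ | leafᶜ = ⊥-elim (i≢j refl)
tripleTree-conditionC {s = a , b , c} (a≢b , _ , _) (0 ∷ []) _ i j q q' _ _ refl i≢j lx ly
  with tripleTree-leaf {a = a} {b} {c} (0 ∷ i ∷ q) lx
     | tripleTree-leaf {a = a} {b} {c} (0 ∷ j ∷ q') ly
... | leafᵃ | leafᵇ = a≢b
... | leafᵇ | leafᵃ = λ b≡a → a≢b (sym b≡a)
... | leafᵃ | leafᵃ = ⊥-elim (i≢j refl)
... | leafᵇ | leafᵇ = ⊥-elim (i≢j refl)
tripleTree-conditionC _ (0 ∷ 0 ∷ w) _ _ _ _ _ _ _ h = ⊥-elim (at-leaf≢node w h)
tripleTree-conditionC _ (0 ∷ 1 ∷ w) _ _ _ _ _ _ _ h = ⊥-elim (at-leaf≢node w h)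
tripleTree-conditionC _ (0 ∷ suc (suc _) ∷ _) _ _ _ _ _ _ _ ()
tripleTree-conditionC _ (1 ∷ w) _ _ _ _ _ _ _ h = ⊥-elim (at-leaf≢node w h)
tripleTree-conditionC _ (suc (suc _) ∷ _) _ _ _ _ _ _ _ ()

lcp-cons : ∀ k p q → lcp (k ∷ p) (k ∷ q) ≡ k ∷ lcp p q
lcp-cons k p q rewrite dec-true (k ≟ k) refl = refl

lca₃-cons : ∀ k x y z → lca₃ (k ∷ x) (k ∷ y) (k ∷ z) ≡ k ∷ lca₃ x y z
lca₃-cons k x y z rewrite lcp-cons k x y = lcp-cons k (lcp x y) z

lcp-cons⁻ : ∀ p q {k w} → lcp p q ≡ k ∷ w →
  ∃ λ p' → ∃ λ q' → p ≡ k ∷ p' × q ≡ k ∷ q' × w ≡ lcp p' q'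
lcp-cons⁻ [] _ ()
lcp-cons⁻ (_ ∷ _) [] ()
lcp-cons⁻ (i ∷ p) (j ∷ q) h with i ≟ j
... | yes refl with trans (sym (lcp-cons i p q)) h
...   | refl = p , q , refl , refl , refl
lcp-cons⁻ (i ∷ p) (j ∷ q) h | no i≢j rewrite dec-false (i ≟ j) i≢j with h
... | ()

lca₃-cons⁻ : ∀ x y z {k w} → lca₃ x y z ≡ k ∷ w →
  ∃ λ x' → ∃ λ y' → ∃ λ z' →
    x ≡ k ∷ x' × y ≡ k ∷ y' × z ≡ k ∷ z' × w ≡ lca₃ x' y' z'
lca₃-cons⁻ x y z h with lcp-cons⁻ (lcp x y) z h
... | _ , z' , xy≡ku , refl , refl with lcp-cons⁻ x y xy≡ku
... | x' , y' , refl , refl , refl = x' , y' , z' , refl , refl , refl , refl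

≺-cons : ∀ k {u v} → u ≺ v → (k ∷ u) ≺ (k ∷ v)
≺-cons _ (s , s≢[] , refl) = s , s≢[] , refl

≺-uncons : ∀ k {u v} → (k ∷ u) ≺ (k ∷ v) → u ≺ v
≺-uncons _ (s , s≢[] , eq) = s , s≢[] , ∷-injectiveʳ eq

¬[]≺ : ∀ v → ¬ ([] ≺ v)
¬[]≺ v (s , s≢[] , eq) = s≢[] (++-conicalʳ v s (sym eq))

module _ {B} {T t : Tree B} {k} (child : ∀ q → at T (k ∷ q) ≡ at t q) where

  GeneTriple-child⁺ : ∀ {x y z a b c} →
    GeneTriple t x y z a b c → GeneTriple T (k ∷ x) (k ∷ y) (k ∷ z) a b c
  GeneTriple-child⁺ {x} {y} {z}
    (lx , ly , lz , x≢y , x≢z , y≢z , lca≺ , (us , lca-spec) , a≢b , a≢c , b≢c) =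
    trans (child x) lx , trans (child y) ly , trans (child z) lz ,
    ∷-≢ x≢y , ∷-≢ x≢z , ∷-≢ y≢z ,
    subst₂ _≺_ (sym (lcp-cons k x y)) (sym (lca₃-cons k x y z)) (≺-cons k lca≺) ,
    (us , subst (λ w → at T w ≡ just (node spec us)) (sym (lca₃-cons k x y z))
                (trans (child _) lca-spec)) ,
    a≢b , a≢c , b≢c
    where
    ∷-≢ : ∀ {u v} → u ≢ v → k ∷ u ≢ k ∷ v
    ∷-≢ u≢v eq = u≢v (∷-injectiveʳ eq)

  GeneTriple-child⁻ : ∀ {x y z a b c} →
    GeneTriple T (k ∷ x) (k ∷ y) (k ∷ z) a b c → GeneTriple t x y z a b c
  GeneTriple-child⁻ {x} {y} {z}
    (lx , ly , lz , x≢y , x≢z , y≢z , lca≺ , (us , lca-spec) , a≢b , a≢c , b≢c) =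
    trans (sym (child x)) lx , trans (sym (child y)) ly , trans (sym (child z)) lz ,
    (λ eq → x≢y (cong (k ∷_) eq)) , (λ eq → x≢z (cong (k ∷_) eq)) ,
    (λ eq → y≢z (cong (k ∷_) eq)) ,
    ≺-uncons k (subst₂ _≺_ (lcp-cons k x y) (lca₃-cons k x y z) lca≺) ,
    (us , trans (sym (child _))
                (subst (λ w → at T w ≡ just (node spec us)) (lca₃-cons k x y z) lca-spec)) ,
    a≢b , a≢c , b≢c

leaf-∉𝔖 : ∀ {m} {r : Triple m} a → ¬ (r ∈𝔖 leaf a)
leaf-∉𝔖 _ (x , y , z , _ , _ , _ , (_ , _ , _ , _ , _ , _ , _ , (_ , lca-spec) , _) , _) =
  at-leaf≢node (lca₃ x y z) lca-spec

node-∈𝔖⁺ : ∀ {m} {r : Triple m} {e ts t} → t ∈ ts → r ∈𝔖 t → r ∈𝔖 node e ts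
node-∈𝔖⁺ t∈ts (x , y , z , a , b , c , g , same) with atList-index t∈ts
... | k , child = k ∷ x , k ∷ y , k ∷ z , a , b , c , GeneTriple-child⁺ child g , same

dup-root-not-lca : ∀ {B} {ts : List (Tree B)} w {us} →
  at (node dup ts) w ≡ just (node spec us) → ∃ λ k → ∃ λ w' → w ≡ k ∷ w'
dup-root-not-lca [] ()
dup-root-not-lca (k ∷ w') _ = k , w' , refl

dup-∈𝔖⁻ : ∀ {m} {r : Triple m} {ts} → r ∈𝔖 node dup ts → ∃ λ t → t ∈ ts × r ∈𝔖 t
dup-∈𝔖⁻ {ts = ts}
  (x , y , z , a , b , c , g@(lx , _ , _ , _ , _ , _ , _ , (_ , lca-spec) , _) , same)
  with dup-root-not-lca (lca₃ x y z) lca-spec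
... | k , _ , lca≡ with lca₃-cons⁻ x y z lca≡
... | x' , y' , z' , refl , refl , refl , _ with atList-child ts k lx
... | t , t∈ts , child =
  t , t∈ts , x' , y' , z' , a , b , c , GeneTriple-child⁻ child g , same

SameTriple-trans : ∀ {A : Set} (r s t : A × A × A) →
  SameTriple r s → SameTriple s t → SameTriple r t
SameTriple-trans _ _ _ (refl , inj₁ (refl , refl)) st = st
SameTriple-trans _ _ _ (refl , inj₂ (refl , refl)) (refl , inj₁ (refl , refl)) =
  refl , inj₂ (refl , refl)
SameTriple-trans _ _ _ (refl , inj₂ (refl , refl)) (refl , inj₂ (refl , refl)) =
  refl , inj₁ (refl , refl)

tripleTree-cherry : ∀ {m} {a b c a' b' c' : Fin m} {x y z} →
  TripleTreeLeaf a b c x a' → TripleTreeLeaf a b c y b' → TripleTreeLeaf a b c z c' →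
  x ≢ y → x ≢ z → y ≢ z → lca₂ x y ≺ lca₃ x y z →
  SameTriple (a , b , c) (a' , b' , c')
tripleTree-cherry leafᵃ leafᵇ leafᶜ _ _ _ _ = refl , inj₁ (refl , refl)
tripleTree-cherry leafᵇ leafᵃ leafᶜ _ _ _ _ = refl , inj₂ (refl , refl)
tripleTree-cherry leafᵃ leafᵇ leafᵃ _ x≢z _ _ = ⊥-elim (x≢z refl)
tripleTree-cherry leafᵃ leafᵇ leafᵇ _ _ y≢z _ = ⊥-elim (y≢z refl)
tripleTree-cherry leafᵇ leafᵃ leafᵃ _ _ y≢z _ = ⊥-elim (y≢z refl)
tripleTree-cherry leafᵇ leafᵃ leafᵇ _ x≢z _ _ = ⊥-elim (x≢z refl)
tripleTree-cherry leafᵃ leafᵃ _ x≢y _ _ _ = ⊥-elim (x≢y refl)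
tripleTree-cherry leafᵇ leafᵇ _ x≢y _ _ _ = ⊥-elim (x≢y refl)
tripleTree-cherry leafᶜ leafᶜ _ x≢y _ _ _ = ⊥-elim (x≢y refl)
tripleTree-cherry leafᵃ leafᶜ _ _ _ _ lca≺ = ⊥-elim (¬[]≺ _ lca≺)
tripleTree-cherry leafᵇ leafᶜ _ _ _ _ lca≺ = ⊥-elim (¬[]≺ _ lca≺)
tripleTree-cherry leafᶜ leafᵃ _ _ _ _ lca≺ = ⊥-elim (¬[]≺ _ lca≺)
tripleTree-cherry leafᶜ leafᵇ _ _ _ _ lca≺ = ⊥-elim (¬[]≺ _ lca≺)

tripleTree-∈𝔖⁺ : ∀ {m} {s r : Triple m} → ValidTriple s → SameTriple s r →
  r ∈𝔖 tripleTree s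
tripleTree-∈𝔖⁺ {s = a , b , c} (a≢b , a≢c , b≢c) same =
  0 ∷ 0 ∷ [] , 0 ∷ 1 ∷ [] , 1 ∷ [] , a , b , c ,
  (refl , refl , refl , (λ ()) , (λ ()) , (λ ()) , (0 ∷ [] , (λ ()) , refl) ,
   (_ , refl) , a≢b , a≢c , b≢c) ,
  same

tripleTree-∈𝔖⁻ : ∀ {m} {s r : Triple m} → r ∈𝔖 tripleTree s → SameTriple s r
tripleTree-∈𝔖⁻ {s = s@(a , b , c)}
  (x , y , z , a' , b' , c' , (lx , ly , lz , x≢y , x≢z , y≢z , lca≺ , _) , same) =
  SameTriple-trans s (a' , b' , c') _
    (tripleTree-cherry (tripleTree-leaf x lx) (tripleTree-leaf y ly) (tripleTree-leaf z lz)
                       x≢y x≢z y≢z lca≺)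
    same

-- The extra leaf gives the root a child even when X is empty; it needs B ≠ ∅.
geneTree : ∀ {n} → List (Triple (suc n)) → Tree (Fin (suc n))
geneTree X = node dup (leaf Fin.zero ∷ map tripleTree X)

geneTree-phylogenetic : ∀ {n} (X : List (Triple (suc n))) → Phylogenetic (geneTree X)
geneTree-phylogenetic X =
  node-phylogenetic (s≤s z≤n) (leaf-branching Fin.zero ∷ map⁺ (universal tripleTree-branching X))

geneTree-conditionC : ∀ {n} {X : List (Triple (suc n))} → All ValidTriple X →
  ConditionC (geneTree X)
geneTree-conditionC valid =
  dup-conditionC (leaf-conditionC Fin.zero ∷ map⁺ (All.map tripleTree-conditionC valid))

geneTree-∈𝔖 : ∀ {n} {X : List (Triple (suc n))} → All ValidTriple X →
  ∀ r → r ∈T X ⇔ r ∈𝔖 geneTree X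
geneTree-∈𝔖 {X = X} valid r = mk⇔ to from
  where
  to : r ∈T X → r ∈𝔖 geneTree X
  to (s , s∈X , same) =
    node-∈𝔖⁺ (there (∈-map⁺ tripleTree s∈X)) (tripleTree-∈𝔖⁺ (All.lookup valid s∈X) same)

  from : r ∈𝔖 geneTree X → r ∈T X
  from r∈𝔖 with dup-∈𝔖⁻ r∈𝔖
  ... | _ , here refl , r∈leaf = ⊥-elim (leaf-∉𝔖 Fin.zero r∈leaf)
  ... | _ , there t∈map , r∈t with ∈-map⁻ tripleTree t∈map
  ... | s , s∈X , refl = s , s∈X , tripleTree-∈𝔖⁻ r∈t

theorem3 : (n : ℕ) (X : List (Triple (suc n))) → All ValidTriple X →
    ∃ λ (T : Tree (Fin (suc n))) → Phylogenetic T × ConditionC T ×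
    (∀ (r : Triple (suc n)) → (r ∈T X) ⇔ (r ∈𝔖 T))
theorem3 n X valid =
  geneTree X , geneTree-phylogenetic X , geneTree-conditionC valid , geneTree-∈𝔖 valid
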